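{- Let $G$ be a bipartite graph with parts $A,B$, let $k_A,k_B,r$ be positive integers, and suppose $G$ is not $(k_A,k_B)$-choosable. Then neither the $r$-fold blowup $G^{\curlyvee r}$ nor the $r^{k_A}$-fold expansion $G^{\curlywedge r^{k_A}}$ is $(k_A, rk_B)$-choosable.
   Context: All graphs are finite and simple. For a bipartite graph $G$ with bipartition $V = A \sqcup B$ and positive integers $k_A, k_B$, $G$ is $(k_A,k_B)$-choosable if for every set of colors $C$ and every list assignment $L$ assigning to each vertex of $A$ a $k_A$-element subset of $C$ and to each vertex of $B$ a $k_B$-element subset of $C$, there is a map $c\colon V\to C$ with $c(v)\in L(v)$ for all $v$ and $c(v)\neq c(v')$ for every edge $vv'$. For a positive integer $r$, the $r$-fold blowup $G^{\curlyvee r}$ is the bipartite graph with parts $A' = A\times[r]$ and $B' = B^r$, where $(v,i)\in A'$ is adjacent to $(v_1,\ldots,v_r)\in B'$ if and only if $vv_i$ is an edge of $G$; its $A$-part is $A'$ and its $B$-part is $B'$. The $m$-fold expansion $G^{\curlywedge m}$ is the bipartite graph obtained from $G$ by replacing each vertex of $A$ by $m$ copies of itself, each adjacent to the same vertices of $B$ as the original; its $A$-part consists of the copies and its $B$-part is $B$. -}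

module Defs where

open import Data.Nat using (ℕ; _*_; _^_)
open import Data.Fin using (Fin)
open import Data.Bool using (Bool; true)
open import Data.Product using (_×_; _,_; Σ; ∃)
open import Relation.Binary.PropositionalEquality using (_≡_; _≢_)
open import Relation.Nullary using (¬_)
open import Function.Definitions using (Injective)

record BipGraph (A B : Set) : Set where
  field
    adj : A → B → Bool
open BipGraph public

-- A k-element subset of the colour set C, presented as an injective
-- enumeration Fin k → C.  A list assignment gives each vertex such a list.
ListOf : ℕ → Set → Set
ListOf k C = Fin k → C

Choosable : {A B : Set} → BipGraph A B → ℕ → ℕ → Set₁
Choosable {A} {B} G kA kB =
  (C : Set)
  (LA : A → ListOf kA C) (LB : B → ListOf kB C) →
  (∀ a → Injective _≡_ _≡_ (LA a)) →
  (∀ b → Injective _≡_ _≡_ (LB b)) →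
  Σ (A → C) λ cA → Σ (B → C) λ cB →
    (∀ a → ∃ λ i → LA a i ≡ cA a) ×
    (∀ b → ∃ λ j → LB b j ≡ cB b) ×
    (∀ a b → adj G a b ≡ true → cA a ≢ cB b)

blowup : {A B : Set} → BipGraph A B → (r : ℕ) → BipGraph (A × Fin r) (Fin r → B)
blowup G r = record { adj = λ { (v , i) w → adj G v (w i) } }

expansion : {A B : Set} → BipGraph A B → (m : ℕ) → BipGraph (A × Fin m) B
expansion G m = record { adj = λ { (v , i) w → adj G v w } }

-- Given lists L for G, use colours C × Fin r. In the blowup, (a , i) gets L a
-- tagged by i; in the expansion, the copy y of a, read as y : Fin kA → Fin r,
-- gets L a with its j-th colour tagged by y j. A B-vertex t of the blowup gets
-- the union of the L (t q) tagged by q, and a B-vertex w of the expansion the r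
-- tagged copies of L w. A proper colouring of the large graph gives every
-- B-vertex a tag, and the diagonal argument of fibre-eval-surjective fixes a
-- tag i (blowup), resp. for each a a list position j (expansion), that is hit
-- by all B-vertices of G, resp. all tags. Reading off first coordinates there
-- gives an L-colouring of G, since equal colours would also carry equal tags.
module Submission where

open import Defs
open import Data.Nat using (ℕ; _*_; _^_; _≥_)
open import Data.Fin using (Fin; quotient; remainder; finToFun; funToFin; _≟_)
open import Data.Fin.Properties
  using (any?; all?; ¬∀⟶∃¬; *↔×; finToFun-funToFin)
open import Data.Product using (_×_; Σ; ∃; _,_; proj₁; proj₂)
open import Data.Product.Properties using (,-injective; ×-≡,≡→≡)
open import Data.Bool using (true)
open import Function.Base using (_∘_; const)
open import Function.Bundles using (Injection)
open import Function.Definitions using (Injective)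
open import Function.Properties.Inverse using (Inverse⇒Injection)
open import Relation.Binary.PropositionalEquality
open import Relation.Nullary using (¬_; Dec; yes; no; contradiction)
open import Relation.Nullary.Decidable using (_×-dec_)

module _ {m n : ℕ} (J : Fin (m ^ n) → Fin n) where

  Hits : Fin n → Fin m → Set
  Hits i x = ∃ λ y → J y ≡ i × finToFun y i ≡ x

  hits? : ∀ i x → Dec (Hits i x)
  hits? i x = any? (λ y → (J y ≟ i) ×-dec (finToFun y i ≟ x))

  -- A diagonal argument: if every i missed some value xᵢ, the function i ↦ xᵢ
  -- would itself be a y with J y = i and finToFun y i = xᵢ for i = J y.
  fibre-eval-surjective : ∃ λ i → ∀ x → Hits i x
  fibre-eval-surjective with any? (λ i → all? (hits? i))
  ... | yes full = full
  ... | no ¬full = contradiction (y , refl , finToFun-funToFin missed (J y)) (proj₂ (missing (J y)))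
    where
    missing : ∀ i → ∃ λ x → ¬ Hits i x
    missing i = ¬∀⟶∃¬ m (Hits i) (hits? i) (λ hitsAll → ¬full (i , hitsAll))
    missed : Fin n → Fin m
    missed = proj₁ ∘ missing
    y : Fin (m ^ n)
    y = funToFin missed

ListColouring : {A B C : Set} {kA kB : ℕ} → BipGraph A B →
  (A → ListOf kA C) → (B → ListOf kB C) → Set
ListColouring {A} {B} {C} G LA LB = Σ (A → C) λ cA → Σ (B → C) λ cB →
  (∀ a → ∃ λ i → LA a i ≡ cA a) ×
  (∀ b → ∃ λ j → LB b j ≡ cB b) ×
  (∀ a b → adj G a b ≡ true → cA a ≢ cB b)

module _ {C : Set} {k r : ℕ} where

  label : ListOf k C → (Fin k → Fin r) → ListOf k (C × Fin r)
  label L f j = L j , f j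

  label-injective : ∀ {L} f → Injective _≡_ _≡_ L → Injective _≡_ _≡_ (label L f)
  label-injective f injL = injL ∘ proj₁ ∘ ,-injective

  label-tag : ∀ {L} f {j c} → label L f j ≡ c → proj₂ c ≡ f j
  label-tag f refl = refl

  stack : (Fin r → ListOf k C) → ListOf (r * k) (C × Fin r)
  stack L m = L (quotient {r} k m) (remainder {r} k m) , quotient {r} k m

  stack-injective : ∀ {L} → (∀ q → Injective _≡_ _≡_ (L q)) →
    Injective _≡_ _≡_ (stack L)
  stack-injective {L} injL {m} {m'} eq with ,-injective eq
  ... | sameColour , sameQuotient =
    Injection.injective (Inverse⇒Injection *↔×) (×-≡,≡→≡ (sameQuotient , sameRemainder))
    where
    sameRemainder : remainder {r} k m ≡ remainder {r} k m'
    sameRemainder = injL (quotient {r} k m')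
      (subst (λ q → L q (remainder {r} k m) ≡ L (quotient {r} k m') (remainder {r} k m'))
             sameQuotient sameColour)

  stack-∈ : ∀ L {m c} → stack L m ≡ c → L (proj₂ c) (remainder {r} k m) ≡ proj₁ c
  stack-∈ L refl = refl

module _ {A : Set} {nB : ℕ} (G : BipGraph A (Fin nB)) {C : Set} {kA kB r : ℕ}
         (LA : A → ListOf kA C) (LB : Fin nB → ListOf kB C) where

  blowup-colouring⇒colouring :
    ListColouring (blowup G r) (λ { (a , i) → label (LA a) (const i) }) (λ t → stack (LB ∘ t)) →
    ListColouring G LA LB
  blowup-colouring⇒colouring (cA' , cB' , cA'-∈ , cB'-∈ , proper') =
    cA , cB , cA-∈ , cB-∈ , proper
    where
    tagOf : Fin (nB ^ r) → Fin r
    tagOf = proj₂ ∘ cB' ∘ finToFun {nB} {r}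
    chosen : ∃ λ i → ∀ w → Hits tagOf i w
    chosen = fibre-eval-surjective tagOf
    i : Fin r
    i = proj₁ chosen
    witness : Fin nB → Fin (nB ^ r)
    witness w = proj₁ (proj₂ chosen w)

    cA : A → C
    cA a = proj₁ (cA' (a , i))
    cB : Fin nB → C
    cB w = proj₁ (cB' (finToFun (witness w)))

    cA-∈ : ∀ a → ∃ λ j → LA a j ≡ cA a
    cA-∈ a = proj₁ (cA'-∈ (a , i)) , cong proj₁ (proj₂ (cA'-∈ (a , i)))

    cB-∈ : ∀ w → ∃ λ j → LB w j ≡ cB w
    cB-∈ w with proj₂ chosen w
    ... | y , sameTag , refl with cB'-∈ (finToFun y)
    ...   | m , eq = remainder {r} kB m ,
      subst (λ q → LB (finToFun y q) (remainder {r} kB m) ≡ proj₁ (cB' (finToFun y)))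
            sameTag (stack-∈ (LB ∘ finToFun y) eq)

    proper : ∀ a w → adj G a w ≡ true → cA a ≢ cB w
    proper a w edge sameColour with proj₂ chosen w
    ... | y , sameTag , refl = proper' (a , i) (finToFun y) edge
      (×-≡,≡→≡ (sameColour , trans (label-tag {L = LA a} (const i) (proj₂ (cA'-∈ (a , i))))
                                   (sym sameTag)))

blowup-reflects-choosability : ∀ {A nB} (G : BipGraph A (Fin nB)) kA kB r →
  Choosable (blowup G r) kA (r * kB) → Choosable G kA kB
blowup-reflects-choosability G kA kB r choose C LA LB injA injB =
  blowup-colouring⇒colouring G LA LB (choose (C × Fin r) _ _
    (λ { (a , i) → label-injective (const i) (injA a) })
    (λ t → stack-injective (injB ∘ t)))

module _ {A B : Set} (G : BipGraph A B) {C : Set} {kA kB r : ℕ}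
         (LA : A → ListOf kA C) (LB : B → ListOf kB C) where

  expansion-colouring⇒colouring :
    ListColouring (expansion G (r ^ kA))
      (λ { (a , y) → label (LA a) (finToFun y) }) (λ w → stack (const (LB w))) →
    ListColouring G LA LB
  expansion-colouring⇒colouring (cA' , cB' , cA'-∈ , cB'-∈ , proper') =
    cA , cB , (λ a → chosen a , refl) , cB-∈ , proper
    where
    chosenFull : ∀ a → ∃ λ j → ∀ x → Hits (λ y → proj₁ (cA'-∈ (a , y))) j x
    chosenFull a = fibre-eval-surjective (λ y → proj₁ (cA'-∈ (a , y)))
    chosen : A → Fin kA
    chosen = proj₁ ∘ chosenFull

    cA : A → C
    cA a = LA a (chosen a)
    cB : B → C
    cB = proj₁ ∘ cB'

    cB-∈ : ∀ w → ∃ λ j → LB w j ≡ cB w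
    cB-∈ w with cB'-∈ w
    ... | m , eq = remainder {r} kB m , stack-∈ (const (LB w)) eq

    proper : ∀ a w → adj G a w ≡ true → cA a ≢ cB w
    proper a w edge sameColour with proj₂ (chosenFull a) (proj₂ (cB' w))
    ... | y , chosenByY , sameTag = proper' (a , y) w edge (begin
      cA' (a , y)                                     ≡⟨ proj₂ (cA'-∈ (a , y)) ⟨
      label (LA a) (finToFun y) (proj₁ (cA'-∈ (a , y))) ≡⟨ cong (label (LA a) (finToFun y)) chosenByY ⟩
      label (LA a) (finToFun y) (chosen a)              ≡⟨ ×-≡,≡→≡ (sameColour , sameTag) ⟩
      cB' w                                           ∎)
      where open ≡-Reasoning

expansion-reflects-choosability : ∀ {A B} (G : BipGraph A B) kA kB r →
  Choosable (expansion G (r ^ kA)) kA (r * kB) → Choosable G kA kB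
expansion-reflects-choosability G kA kB r choose C LA LB injA injB =
  expansion-colouring⇒colouring G LA LB (choose (C × Fin r) _ _
    (λ { (a , y) → label-injective (finToFun y) (injA a) })
    (λ w → stack-injective (const (injB w))))

lemma3p3 : (nA nB : ℕ) (G : BipGraph (Fin nA) (Fin nB)) (kA kB r : ℕ) →
    kA ≥ 1 → kB ≥ 1 → r ≥ 1 →
    ¬ Choosable G kA kB →
    ¬ Choosable (blowup G r) kA (r * kB) × ¬ Choosable (expansion G (r ^ kA)) kA (r * kB)
lemma3p3 nA nB G kA kB r _ _ _ notChoosable =
  notChoosable ∘ blowup-reflects-choosability G kA kB r ,
  notChoosable ∘ expansion-reflects-choosability G kA kB r
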